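{- For every $\delta>0$ and $n\in\mathbb{N}$ there exists $N\in\mathbb{N}$ such that the following holds for every $N$-partitioned hypergraph $H$ and every choice of subsets $C_{ijk\ell}\subseteq V_{ik}$, $i<j<k<\ell$, $i,j,k,\ell\in[N]$, with $|C_{ijk\ell}|\ge\delta|V_{ik}|$. There exist an induced $n$-partitioned subhypergraph of $H$ with index set $I\subseteq[N]$ and vertices $\gamma_{ik}$, $i<k$, $i,k\in I$, such that $\gamma_{ik}\in C_{ijk\ell}$ for all $j,\ell\in I$ with $i<j<k<\ell$.
   Context: An $N$-partitioned hypergraph $H$ is a $3$-uniform hypergraph whose vertex set is partitioned into nonempty finite sets $V_{ij}$, $1\le i<j\le N$, such that every edge has one vertex in each of $V_{ij},V_{ik},V_{jk}$ for some $1\le i<j<k\le N$. For $I\subseteq[N]$, the subhypergraph induced by $I$ is the $|I|$-partitioned hypergraph with parts $V_{ij}$, $i<j$, $i,j\in I$ (keeping original indices) and all edges of $H$ contained in the union of these parts; $I$ is its index set.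
   Formalization: The parameter δ ranges over the positive rationals. -}

module Defs where

open import Level using (Level; suc; _⊔_)
open import Data.Nat using (ℕ; _≤_; _*_)
open import Data.Fin using (Fin; _<_)
open import Data.Fin.Subset using (Subset; ∣_∣)
open import Data.Product using (_×_)

-- An N-partitioned hypergraph: the vertex set is the disjoint union of the
-- parts V_ij (i < j in Fin N); part V_ij is Fin (size i j) and is nonempty.
-- (size i j for i ≥ j is unused.)  Edges are triples with one vertex in each
-- of V_ij, V_ik, V_jk for some i < j < k, given by a relation 'edge'.
record PartitionedHypergraph (N : ℕ) : Set₁ where
  field
    size     : Fin N → Fin N → ℕ
    nonempty : ∀ {i j} → i < j → 1 ≤ size i j
    edge     : ∀ {i j k} → i < j → j < k →
               Fin (size i j) → Fin (size i k) → Fin (size j k) → Set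

open PartitionedHypergraph public

Choice : ∀ {N} → PartitionedHypergraph N → Set
Choice {N} H = ∀ {i j k l : Fin N} → .(i < j) → .(j < k) → .(k < l) → Subset (size H i k)

-- |C_ijkl| ≥ δ |V_ik| with δ = p / q  (written q |C| ≥ p |V|).
Dense : ∀ {N} (H : PartitionedHypergraph N) → ℕ → ℕ → Choice H → Set
Dense {N} H p q C = ∀ {i j k l : Fin N} (ij : i < j) (jk : j < k) (kl : k < l) →
  p * size H i k ≤ q * ∣ C ij jk kl ∣

-- An index set I ⊆ [N] with |I| = n, listed increasingly: a strictly
-- increasing map ι : Fin n → Fin N.  The induced n-partitioned
-- subhypergraph is determined by I (parts V_{ι a ι b} and all edges of H inside).
StrictlyIncreasing : ∀ {n N} → (Fin n → Fin N) → Set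
StrictlyIncreasing {n} ι = ∀ {a b : Fin n} → a < b → ι a < ι b

{-# OPTIONS --safe #-}
-- Colour every n-element sublist Z of [N], read as an increasing map ι, once for
-- each pair of positions a < c: Z is good for (a , c) if some vertex x of
-- V_{ι a ι c} lies in C_{ι a ι b ι c ι d} for all a < b < c < d.  Ramsey's theorem,
-- applied to these n² colourings at once, gives a long sorted J on which all of
-- them are constant.  Each constant colour is "good": split J as
-- pre ++ i ∷ M ++ k ∷ L with |pre| = a.  Averaging over V_ik yields a point x
-- lying in a δ-fraction of the sets C_ijkl (j ∈ M, l ∈ L), so many rows j are
-- heavy (x ∈ C_ijkl for at least t columns l); among them s + 1 rows agree on all
-- of L, and these rows with the columns of one of them form an s × t rectangle of
-- sets containing x.  Splicing the rectangle into J gives a good sublist.  Hence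
-- the first n elements of J are good for every pair, and the witnesses x are the
-- vertices γ.
module Submission where

open import Defs

open import Data.Bool using (Bool; true; false; if_then_else_)
import Data.Bool as Bool
open import Data.Fin using (Fin; zero; suc; toℕ; _<_)
open import Data.Fin.Properties using (<-trans; _<?_; any?; all?; toℕ<n)
open import Data.Fin.Subset as Subset using (Subset; ∣_∣; _∈_)
open import Data.Fin.Subset.Properties using (_∈?_)
open import Data.List using (List; []; _∷_; length; map; filter; take; _++_; tabulate; allFin; cartesianProduct)
open import Data.List.Properties using (length-map; length-take; length-tabulate; length-filter; length-++; map-tabulate)
open import Data.List.Membership.Propositional renaming (_∈_ to _∈ₗ_)
open import Data.List.Membership.Propositional.Properties using (∈-++⁺ʳ; ∈-++⁺ˡ; ∈-allFin; ∈-cartesianProduct⁺)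
open import Data.List.Relation.Binary.Sublist.Propositional using (_⊆_; []; _∷_; _∷ʳ_; ⊆-refl; ⊆-trans; minimum)
open import Data.List.Relation.Binary.Sublist.Propositional.Properties
  using (map⁺; filter-⊆; take-⊆; All-resp-⊆; Any-resp-⊆; ++⁺; ++⁺ˡ)
open import Data.List.Relation.Unary.All as All using (All; []; _∷_)
open import Data.List.Relation.Unary.All.Properties using (all-filter)
open import Data.List.Relation.Unary.AllPairs as AllPairs using (AllPairs; []; _∷_)
open import Data.List.Relation.Unary.AllPairs.Properties using (tabulate⁺-<)
open import Data.List.Relation.Unary.Any using (here; there)
open import Data.Nat using (ℕ; zero; suc; _+_; _*_; _^_; _≤_; z≤n; s≤s; NonZero; >-nonZero)
import Data.Nat as ℕ
open import Data.Nat.Properties hiding (<-trans; _<?_)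
open import Algebra.Properties.CommutativeSemigroup +-commutativeSemigroup using (interchange; x∙yz≈y∙xz)
open import Data.Nat.Tactic.RingSolver using (solve-∀)
open import Data.Product using (Σ; ∃; ∃₂; _×_; _,_; proj₁; proj₂)
open import Data.Unit using (⊤; tt)
open import Data.Vec using ([]; _∷_)
open import Function using (_∘_; id)
open import Relation.Binary.PropositionalEquality
open import Relation.Nullary using (Dec; yes; no; does; ¬_; contradiction)
open import Relation.Nullary.Decidable using (dec-true; _→-dec_; recompute)
open import Relation.Unary using (Decidable)

private
  variable
    A B : Set
    m : ℕ
    xs ys : List A

∑ : List A → (A → ℕ) → ℕ
∑ [] g = 0
∑ (x ∷ xs) g = g x + ∑ xs g

syntax ∑ xs (λ x → e) = ∑[ x ∈ xs ] e

∑-+ : ∀ (xs : List A) g h → ∑[ x ∈ xs ] (g x + h x) ≡ ∑ xs g + ∑ xs h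
∑-+ [] g h = refl
∑-+ (x ∷ xs) g h rewrite ∑-+ xs g h = interchange (g x) (h x) (∑ xs g) (∑ xs h)

*-distribˡ-∑ : ∀ q (xs : List A) g → q * ∑ xs g ≡ ∑[ x ∈ xs ] (q * g x)
*-distribˡ-∑ q [] g = *-zeroʳ q
*-distribˡ-∑ q (x ∷ xs) g rewrite *-distribˡ-+ q (g x) (∑ xs g) = cong (q * g x +_) (*-distribˡ-∑ q xs g)

∑-const : ∀ (xs : List A) c → ∑[ x ∈ xs ] c ≡ length xs * c
∑-const [] c = refl
∑-const (x ∷ xs) c = cong (c +_) (∑-const xs c)

∑-cong : ∀ (xs : List A) {g h} → (∀ x → g x ≡ h x) → ∑ xs g ≡ ∑ xs h
∑-cong [] eq = refl
∑-cong (x ∷ xs) eq = cong₂ _+_ (eq x) (∑-cong xs eq)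

∑-mono : ∀ (xs : List A) {g h} → (∀ {x} → x ∈ₗ xs → g x ≤ h x) → ∑ xs g ≤ ∑ xs h
∑-mono [] le = z≤n
∑-mono (x ∷ xs) le = +-mono-≤ (le (here refl)) (∑-mono xs (le ∘ there))

∑-comm : ∀ (xs : List A) (ys : List B) (g : A → B → ℕ) → ∑[ x ∈ xs ] ∑[ y ∈ ys ] g x y ≡ ∑[ y ∈ ys ] ∑[ x ∈ xs ] g x y
∑-comm [] ys g = sym (trans (∑-const ys 0) (*-zeroʳ (length ys)))
∑-comm (x ∷ xs) ys g = begin
  ∑ ys (g x) + ∑[ x′ ∈ xs ] ∑[ y ∈ ys ] g x′ y ≡⟨ cong (∑ ys (g x) +_) (∑-comm xs ys g) ⟩
  ∑ ys (g x) + ∑[ y ∈ ys ] ∑[ x′ ∈ xs ] g x′ y ≡⟨ sym (∑-+ ys (g x) _) ⟩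
  ∑[ y ∈ ys ] (g x y + ∑[ x′ ∈ xs ] g x′ y)   ∎
  where open ≡-Reasoning

∑-map : ∀ (h : A → B) xs g → ∑ (map h xs) g ≡ ∑[ x ∈ xs ] g (h x)
∑-map h [] g = refl
∑-map h (x ∷ xs) g = cong (g (h x) +_) (∑-map h xs g)

∃-≥-mean : ∀ {b} (xs : List A) g → 1 ≤ length xs → length xs * b ≤ ∑ xs g → ∃ λ x → b ≤ g x
∃-≥-mean {b = b} (x ∷ xs) g _ = mean-of-cons x xs
  where
  mean-of-cons : ∀ x xs → length (x ∷ xs) * b ≤ ∑ (x ∷ xs) g → ∃ λ y → b ≤ g y
  mean-of-cons x [] le = x , +-cancelʳ-≤ 0 b (g x) le
  mean-of-cons x (y ∷ xs) le with b ≤? g x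
  ... | yes b≤gx = x , b≤gx
  ... | no b≰gx = mean-of-cons y xs (+-cancelˡ-≤ (g x) _ _ (≤-trans (+-monoˡ-≤ _ (<⇒≤ (≰⇒> b≰gx))) le))

∑-≤-filter : ∀ {P : A → Set} (P? : Decidable P) (xs : List A) g {c t} →
  (∀ {x} → x ∈ₗ xs → g x ≤ c) → (∀ {x} → ¬ P x → g x ≤ t) →
  ∑ xs g ≤ length (filter P? xs) * c + length xs * t
∑-≤-filter P? [] g bounded small = z≤n
∑-≤-filter P? (x ∷ xs) g {c} {t} bounded small with P? x | ∑-≤-filter P? xs g (bounded ∘ there) small
... | yes _ | ih = begin
  g x + ∑ xs g                    ≤⟨ +-mono-≤ (bounded (here refl)) ih ⟩
  c + (h * c + length xs * t)     ≡⟨ sym (+-assoc c _ _) ⟩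
  c + h * c + length xs * t       ≤⟨ +-monoʳ-≤ (c + h * c) (m≤n+m _ t) ⟩
  c + h * c + (t + length xs * t) ∎
  where
  open ≤-Reasoning
  h = length (filter P? xs)
... | no ¬Px | ih = begin
  g x + ∑ xs g                ≤⟨ +-mono-≤ (small ¬Px) ih ⟩
  t + (h * c + length xs * t) ≡⟨ x∙yz≈y∙xz t (h * c) _ ⟩
  h * c + (t + length xs * t) ∎
  where
  open ≤-Reasoning
  h = length (filter P? xs)

𝟙 : {P : Set} → Dec P → ℕ
𝟙 d = if does d then 1 else 0

does⇒witness : {P : Set} (d : Dec P) → does d ≡ true → P
does⇒witness (yes p) _ = p

length-filter≡∑𝟙 : ∀ {P : A → Set} (P? : Decidable P) xs → length (filter P? xs) ≡ ∑[ x ∈ xs ] 𝟙 (P? x)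
length-filter≡∑𝟙 P? [] = refl
length-filter≡∑𝟙 P? (x ∷ xs) with does (P? x)
... | true = cong suc (length-filter≡∑𝟙 P? xs)
... | false = length-filter≡∑𝟙 P? xs

∣∣≡∑𝟙 : ∀ {m} (v : Subset m) → ∣ v ∣ ≡ ∑[ x ∈ allFin m ] 𝟙 (x ∈? v)
∣∣≡∑𝟙 [] = refl
∣∣≡∑𝟙 {suc m} (b ∷ v) = split b (begin
  ∣ v ∣                                          ≡⟨ ∣∣≡∑𝟙 v ⟩
  ∑[ x ∈ allFin m ] 𝟙 (x ∈? v)                    ≡⟨ sym (∑-map suc (allFin m) _) ⟩
  ∑ (map suc (allFin m)) (λ x → 𝟙 (x ∈? b ∷ v)) ≡⟨ cong (λ xs → ∑ xs (λ x → 𝟙 (x ∈? b ∷ v))) (map-tabulate id suc) ⟩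
  ∑ (tabulate suc) (λ x → 𝟙 (x ∈? b ∷ v))        ∎)
  where
  open ≡-Reasoning
  split : ∀ c {n} → ∣ v ∣ ≡ n → ∣ c ∷ v ∣ ≡ 𝟙 (zero ∈? c ∷ v) + n
  split true eq = cong suc eq
  split false eq = eq

-- Pigeonhole principles

fibre : (A → Bool) → Bool → List A → List A
fibre g b = filter (λ x → g x Bool.≟ b)

length-fibres : ∀ (g : A → Bool) xs → length (fibre g true xs) + length (fibre g false xs) ≡ length xs
length-fibres g [] = refl
length-fibres g (x ∷ xs) with g x
... | true = cong suc (length-fibres g xs)
... | false = trans (+-suc _ _) (cong suc (length-fibres g xs))

pigeonhole : ∀ (g : A → Bool) {xs} → m + m ≤ length xs →
  ∃₂ λ b ys → ys ⊆ xs × m ≤ length ys × All (λ y → g y ≡ b) ys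
pigeonhole {m = m} g {xs} m+m≤ with m ≤? length (fibre g true xs)
... | yes m≤ = true , fibre g true xs , filter-⊆ _ xs , m≤ , all-filter _ xs
... | no m≰ = false , fibre g false xs , filter-⊆ _ xs , m≤ , all-filter _ xs
  where
  m≤ : m ≤ length (fibre g false xs)
  m≤ = +-cancelˡ-≤ (length (fibre g true xs)) _ _ (begin
    length (fibre g true xs) + m         ≤⟨ +-monoˡ-≤ m (<⇒≤ (≰⇒> m≰)) ⟩
    m + m                                ≤⟨ m+m≤ ⟩
    length xs                            ≡⟨ sym (length-fibres g xs) ⟩
    length (fibre g true xs) + length (fibre g false xs) ∎)
    where open ≤-Reasoning

RowsAgree : (A → B → Bool) → List B → List A → Set
RowsAgree F L S = ∀ {j j′ l} → j ∈ₗ S → j′ ∈ₗ S → l ∈ₗ L → F j l ≡ F j′ l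

rows-agree : ∀ (F : A → B → Bool) (L : List B) {s} {R : List A} → s * 2 ^ length L ≤ length R →
  ∃ λ S → S ⊆ R × s ≤ length S × RowsAgree F L S
rows-agree F [] {s} {R} le = R , ⊆-refl , subst (_≤ length R) (*-identityʳ s) le , λ _ _ ()
rows-agree F (l ∷ L) {s} {R} le with pigeonhole (λ j → F j l) (subst (_≤ length R) (double s (2 ^ length L)) le)
  where
  double : ∀ s x → s * (2 * x) ≡ s * x + s * x
  double s x = trans (cong (λ y → s * (x + y)) (+-identityʳ x)) (*-distribˡ-+ s x x)
... | b , ys , ys⊆R , len , constant with rows-agree F L len
... | S , S⊆ys , lenS , agree = S , ⊆-trans S⊆ys ys⊆R , lenS , agree′
  where
  atl : ∀ {j} → j ∈ₗ S → F j l ≡ b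
  atl j∈S = All.lookup constant (Any-resp-⊆ S⊆ys j∈S)
  agree′ : RowsAgree F (l ∷ L) S
  agree′ j∈S j′∈S (here refl) = trans (atl j∈S) (sym (atl j′∈S))
  agree′ j∈S j′∈S (there l∈L) = agree j∈S j′∈S l∈L

-- Ramsey's theorem for sublists

Homogeneous : ℕ → (List A → Bool) → List A → Bool → Set
Homogeneous r χ Y b = ∀ {Z} → Z ⊆ Y → length Z ≡ r → χ Z ≡ b

homogeneous-⊆ : ∀ {r χ b} {X Y : List A} → Homogeneous r χ Y b → X ⊆ Y → Homogeneous r χ X b
homogeneous-⊆ hom X⊆Y Z⊆X = hom (⊆-trans Z⊆X X⊆Y)

EndHomogeneous : ℕ → (List A → Bool) → List (A × Bool) → Set
EndHomogeneous r χ [] = ⊤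
EndHomogeneous r χ ((x , b) ∷ S) = Homogeneous r (χ ∘ (x ∷_)) (map proj₁ S) b × EndHomogeneous r χ S

endHomogeneous-⊆ : ∀ {r χ} {S′ S : List (A × Bool)} → EndHomogeneous r χ S → S′ ⊆ S → EndHomogeneous r χ S′
endHomogeneous-⊆ e [] = e
endHomogeneous-⊆ (_ , e) (_ ∷ʳ σ) = endHomogeneous-⊆ e σ
endHomogeneous-⊆ (hom , e) (refl ∷ σ) = homogeneous-⊆ hom (map⁺ proj₁ σ) , endHomogeneous-⊆ e σ

monochromatic⇒homogeneous : ∀ {r χ b} (S : List (A × Bool)) → EndHomogeneous r χ S →
  All (λ e → proj₂ e ≡ b) S → Homogeneous (suc r) χ (map proj₁ S) b
monochromatic⇒homogeneous [] _ _ [] ()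
monochromatic⇒homogeneous (_ ∷ S) (_ , e) (_ ∷ mono) (_ ∷ʳ σ) len = monochromatic⇒homogeneous S e mono σ len
monochromatic⇒homogeneous (_ ∷ S) (hom , _) (b′≡b ∷ _) (refl ∷ σ) len = trans (hom σ (suc-injective len)) b′≡b

mutual
  ramseyBound : ℕ → ℕ → ℕ
  ramseyBound zero m = m
  ramseyBound (suc r) m = endHomogeneousBound r (m + m)

  endHomogeneousBound : ℕ → ℕ → ℕ
  endHomogeneousBound r zero = 0
  endHomogeneousBound r (suc L) = suc (ramseyBound r (endHomogeneousBound r L))

mutual
  ramsey : ∀ r m (χ : List A → Bool) {X} → ramseyBound r m ≤ length X →
    ∃₂ λ Y b → Y ⊆ X × m ≤ length Y × Homogeneous r χ Y b
  ramsey zero m χ {X} le = X , χ [] , ⊆-refl , le , λ { {[]} _ _ → refl ; {_ ∷ _} _ () }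
  ramsey (suc r) m χ le with endHomogeneous-sequence r χ (m + m) le
  ... | S , e , S⊆X , len with pigeonhole proj₂ len
  ... | b , S′ , S′⊆S , len′ , mono =
    map proj₁ S′ , b , ⊆-trans (map⁺ proj₁ S′⊆S) S⊆X ,
    subst (m ≤_) (sym (length-map proj₁ S′)) len′ ,
    monochromatic⇒homogeneous S′ (endHomogeneous-⊆ e S′⊆S) mono

  endHomogeneous-sequence : ∀ r (χ : List A → Bool) L {X} → endHomogeneousBound r L ≤ length X →
    ∃ λ S → EndHomogeneous r χ S × map proj₁ S ⊆ X × L ≤ length S
  endHomogeneous-sequence r χ zero {X} le = [] , tt , minimum X , z≤n
  endHomogeneous-sequence r χ (suc L) {x ∷ X} (s≤s le) with ramsey r _ (χ ∘ (x ∷_)) le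
  ... | Y , b , Y⊆X , lenY , hom with endHomogeneous-sequence r χ L lenY
  ... | S , e , S⊆Y , lenS = (x , b) ∷ S , (homogeneous-⊆ hom S⊆Y , e) , refl ∷ ⊆-trans S⊆Y Y⊆X , s≤s lenS

simultaneousBound : ℕ → ℕ → List B → ℕ
simultaneousBound r m [] = m
simultaneousBound r m (_ ∷ is) = ramseyBound r (simultaneousBound r m is)

ramsey-simultaneous : ∀ r m (χ : B → List A → Bool) is {X} → simultaneousBound r m is ≤ length X →
  ∃ λ Y → Y ⊆ X × m ≤ length Y × (∀ {i} → i ∈ₗ is → ∃ (Homogeneous r (χ i) Y))
ramsey-simultaneous r m χ [] {X} le = X , ⊆-refl , le , λ ()
ramsey-simultaneous r m χ (i ∷ is) le with ramsey r _ (χ i) le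
... | Y₁ , b , Y₁⊆X , len₁ , hom with ramsey-simultaneous r m χ is len₁
... | Y , Y⊆Y₁ , len , homs = Y , ⊆-trans Y⊆Y₁ Y₁⊆X , len , λ where
  (here refl) → b , homogeneous-⊆ hom Y⊆Y₁
  (there i∈is) → homs i∈is

-- Dense grids of sets contain rectangles with a common point

-- With |L| = q (t + 1) columns, the counting in many-heavy-rows leaves at least |M| / |L|
-- heavy rows; |M| is chosen so that this is enough for s + 1 of them to share one of
-- the 2 ^ |L| patterns on L.
columns : ℕ → ℕ → ℕ
columns q t = q * suc t

rows : ℕ → ℕ → ℕ → ℕ
rows q s t = columns q t * (suc s * 2 ^ columns q t)

many-heavy-rows : ∀ {p q s t h} .{{_ : NonZero p}} .{{_ : NonZero q}} →
  p * (rows q s t * columns q t) ≤ q * (h * columns q t + rows q s t * t) → suc s * 2 ^ columns q t ≤ h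
many-heavy-rows {p} {q} {s} {t} {h} incidences =
  *-cancelˡ-≤ c {{m*n≢0 q (suc t)}} (subst (c * w ≤_) (*-comm h c) (*-cancelˡ-≤ q
    (+-cancelʳ-≤ (q * (c * w * t)) _ _ (begin
      q * (c * w) + q * (c * w * t) ≡⟨ distribute (c * w) q t ⟩
      c * w * c                     ≤⟨ m≤n*m (c * w * c) p ⟩
      p * (c * w * c)               ≤⟨ incidences ⟩
      q * (h * c + c * w * t)       ≡⟨ *-distribˡ-+ q _ _ ⟩
      q * (h * c) + q * (c * w * t) ∎))))
  where
  open ≤-Reasoning
  c = columns q t
  w = suc s * 2 ^ c
  distribute : ∀ m q t → q * m + q * (m * t) ≡ m * (q * (1 + t))
  distribute = solve-∀

module _ {A B : Set} {m} (f : A → B → Subset m) where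

  degree : List B → A → Fin m → ℕ
  degree L j x = ∑[ l ∈ L ] 𝟙 (x ∈? f j l)

  incidences : List A → List B → Fin m → ℕ
  incidences M L x = ∑[ j ∈ M ] degree L j x

  ∑-incidences : ∀ M L → ∑[ x ∈ allFin m ] incidences M L x ≡ ∑[ j ∈ M ] ∑[ l ∈ L ] ∣ f j l ∣
  ∑-incidences M L = begin
    ∑[ x ∈ allFin m ] ∑[ j ∈ M ] ∑[ l ∈ L ] 𝟙 (x ∈? f j l) ≡⟨ ∑-comm (allFin m) M _ ⟩
    ∑[ j ∈ M ] ∑[ x ∈ allFin m ] ∑[ l ∈ L ] 𝟙 (x ∈? f j l) ≡⟨ ∑-cong M (λ j → ∑-comm (allFin m) L _) ⟩
    ∑[ j ∈ M ] ∑[ l ∈ L ] ∑[ x ∈ allFin m ] 𝟙 (x ∈? f j l) ≡⟨ ∑-cong M (λ j → ∑-cong L (λ l → sym (∣∣≡∑𝟙 (f j l)))) ⟩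
    ∑[ j ∈ M ] ∑[ l ∈ L ] ∣ f j l ∣                          ∎
    where open ≡-Reasoning

  popular-point : ∀ {p q} (M : List A) (L : List B) → 1 ≤ m →
    (∀ {j l} → j ∈ₗ M → l ∈ₗ L → p * m ≤ q * ∣ f j l ∣) →
    ∃ λ x → p * (length M * length L) ≤ q * incidences M L x
  popular-point {p} {q} M L 1≤m dense = ∃-≥-mean (allFin m) _ 1≤length (begin
    length (allFin m) * (p * (length M * length L)) ≡⟨ cong (_* (p * (length M * length L))) (length-tabulate (id {A = Fin m})) ⟩
    m * (p * (length M * length L))                 ≡⟨ rearrange m p (length M) (length L) ⟩
    length M * (length L * (p * m))                 ≡⟨ sym (trans (∑-cong M (λ _ → ∑-const L _)) (∑-const M _)) ⟩
    ∑[ j ∈ M ] ∑[ l ∈ L ] (p * m)                   ≤⟨ ∑-mono M (λ j∈M → ∑-mono L (dense j∈M)) ⟩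
    ∑[ j ∈ M ] ∑[ l ∈ L ] (q * ∣ f j l ∣)           ≡⟨ sym (trans (*-distribˡ-∑ q M _) (∑-cong M (λ j → *-distribˡ-∑ q L _))) ⟩
    q * ∑[ j ∈ M ] ∑[ l ∈ L ] ∣ f j l ∣             ≡⟨ cong (q *_) (sym (∑-incidences M L)) ⟩
    q * ∑[ x ∈ allFin m ] incidences M L x          ≡⟨ *-distribˡ-∑ q (allFin m) _ ⟩
    ∑[ x ∈ allFin m ] (q * incidences M L x)        ∎)
    where
    open ≤-Reasoning
    1≤length : 1 ≤ length (allFin m)
    1≤length = subst (1 ≤_) (sym (length-tabulate (id {A = Fin m}))) 1≤m
    rearrange : ∀ m p M L → m * (p * (M * L)) ≡ M * (L * (p * m))
    rearrange = solve-∀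

  heavyRows : List B → ℕ → Fin m → List A → List A
  heavyRows L t x = filter (λ j → t ≤? degree L j x)

  columnsContaining : List B → A → Fin m → List B
  columnsContaining L j x = filter (λ l → x ∈? f j l) L

  degree≡length : ∀ L j x → degree L j x ≡ length (columnsContaining L j x)
  degree≡length L j x = sym (length-filter≡∑𝟙 _ L)

  incidences-≤ : ∀ M L t x → incidences M L x ≤ length (heavyRows L t x M) * length L + length M * t
  incidences-≤ M L t x = ∑-≤-filter _ M _ (λ {j} _ → degree-≤ j) (<⇒≤ ∘ ≰⇒>)
    where
    degree-≤ : ∀ j → degree L j x ≤ length L
    degree-≤ j = subst (_≤ length L) (sym (degree≡length L j x)) (length-filter _ L)

  many-heavy : ∀ {p q} .{{_ : NonZero p}} .{{_ : NonZero q}} s t {M L} x →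
    length L ≡ columns q t → length M ≡ rows q s t →
    p * (length M * length L) ≤ q * incidences M L x →
    suc s * 2 ^ length L ≤ length (heavyRows L t x M)
  many-heavy {p} {q} s t {M} {L} x lenL lenM popular =
    subst (λ c → suc s * 2 ^ c ≤ h) (sym lenL) (many-heavy-rows {p} {q} {s} {t}
      (subst₂ (λ k c → p * (k * c) ≤ q * (h * c + k * t)) lenM lenL
        (≤-trans popular (*-monoʳ-≤ q (incidences-≤ M L t x)))))
    where
    h = length (heavyRows L t x M)

  agreeing-rows-contain : ∀ {L x j₀ S} → RowsAgree (λ j l → does (x ∈? f j l)) L (j₀ ∷ S) →
    ∀ {j l} → j ∈ₗ j₀ ∷ S → l ∈ₗ columnsContaining L j₀ x → x ∈ f j l
  agreeing-rows-contain {L} {x = x} {j₀} agree j∈S l∈T =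
    does⇒witness (x ∈? _) (trans (agree j∈S (here refl) (Any-resp-⊆ (filter-⊆ _ L) l∈T))
      (dec-true (x ∈? _) (All.lookup (all-filter _ L) l∈T)))

  Rectangle : List A → List B → ℕ → ℕ → Set
  Rectangle M L s t = ∃ λ x → ∃₂ λ S T → S ⊆ M × s ≤ length S × T ⊆ L × t ≤ length T ×
    (∀ {j l} → j ∈ₗ S → l ∈ₗ T → x ∈ f j l)

  dense⇒rectangle : ∀ {p q} .{{_ : NonZero p}} .{{_ : NonZero q}} (s t : ℕ) {M L} → 1 ≤ m →
    length L ≡ columns q t → length M ≡ rows q s t →
    (∀ {j l} → j ∈ₗ M → l ∈ₗ L → p * m ≤ q * ∣ f j l ∣) → Rectangle M L s t
  dense⇒rectangle {p} {q} s t {M} {L} 1≤m lenL lenM dense with popular-point {p} {q} M L 1≤m dense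
  ... | x , popular with rows-agree (λ j l → does (x ∈? f j l)) L (many-heavy {p} {q} s t {M} {L} x lenL lenM popular)
  ... | j₀ ∷ S , S⊆heavy , 1+s≤ , agree =
    x , j₀ ∷ S , columnsContaining L j₀ x , ⊆-trans S⊆heavy (filter-⊆ _ M) , <⇒≤ 1+s≤ ,
    filter-⊆ _ L , subst (t ≤_) (degree≡length L j₀ x) (All.lookup (all-filter _ M) (Any-resp-⊆ S⊆heavy (here refl))) ,
    agreeing-rows-contain {L} agree

AllPairs-resp-⊆ : ∀ {R : A → A → Set} → AllPairs R ys → xs ⊆ ys → AllPairs R xs
AllPairs-resp-⊆ pairs [] = pairs
AllPairs-resp-⊆ (_ ∷ pairs) (_ ∷ʳ σ) = AllPairs-resp-⊆ pairs σ
AllPairs-resp-⊆ (h ∷ pairs) (refl ∷ σ) = All-resp-⊆ σ h ∷ AllPairs-resp-⊆ pairs σ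

AllPairs-++⁻ : ∀ {R : A → A → Set} xs {ys x y} → AllPairs R (xs ++ ys) → x ∈ₗ xs → y ∈ₗ ys → R x y
AllPairs-++⁻ (_ ∷ xs) (h ∷ _) (here refl) y∈ys = All.lookup h (∈-++⁺ʳ xs y∈ys)
AllPairs-++⁻ (_ ∷ xs) (_ ∷ pairs) (there x∈xs) y∈ys = AllPairs-++⁻ xs pairs x∈xs y∈ys

split-around : ∀ k {r} (xs : List A) → k + suc r ≤ length xs →
  ∃₂ λ pre y → ∃ λ post → xs ≡ pre ++ y ∷ post × length pre ≡ k × r ≤ length post
split-around zero (y ∷ post) (s≤s r≤) = [] , y , post , refl , refl , r≤
split-around (suc k) (x ∷ xs) (s≤s le) with split-around k xs le
... | pre , y , post , refl , refl , r≤ = x ∷ pre , y , post , refl , refl , r≤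

length-take≤ : ∀ k (xs : List A) → k ≤ length xs → length (take k xs) ≡ k
length-take≤ k xs k≤ = trans (length-take k xs) (m≤n⇒m⊓n≡m k≤)

frame-sublist : ∀ k₁ k₂ k₃ (xs : List A) → k₁ + suc (k₂ + suc k₃) ≤ length xs →
  ∃₂ λ pre i → ∃₂ λ M k → ∃ λ L →
    pre ++ i ∷ M ++ k ∷ L ⊆ xs × length pre ≡ k₁ × length M ≡ k₂ × length L ≡ k₃
frame-sublist k₁ k₂ k₃ xs le with split-around k₁ xs le
... | pre , i , xs₁ , refl , len-pre , le₁ with split-around k₂ xs₁ le₁
... | M , k , xs₂ , refl , len-M , k₃≤ =
  pre , i , M , k , take k₃ xs₂ , ++⁺ ⊆-refl (refl ∷ ++⁺ ⊆-refl (refl ∷ take-⊆ k₃ xs₂)) ,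
  len-pre , len-M , length-take≤ k₃ xs₂ k₃≤

module _ {A : Set} (⋆ : A) where

  nth : List A → ℕ → A
  nth [] _ = ⋆
  nth (x ∷ xs) zero = x
  nth (x ∷ xs) (suc r) = nth xs r

  nth-++ : ∀ xs {ys} r → nth (xs ++ ys) (length xs + r) ≡ nth ys r
  nth-++ [] r = refl
  nth-++ (x ∷ xs) r = nth-++ xs r

  nth-++ˡ : ∀ xs {ys} r → r ℕ.< length xs → nth (xs ++ ys) r ≡ nth xs r
  nth-++ˡ (x ∷ xs) zero _ = refl
  nth-++ˡ (x ∷ xs) (suc r) (s≤s r<) = nth-++ˡ xs r r<

  nth-∈ : ∀ xs r → r ℕ.< length xs → nth xs r ∈ₗ xs
  nth-∈ (x ∷ xs) zero _ = here refl
  nth-∈ (x ∷ xs) (suc r) (s≤s r<) = there (nth-∈ xs r r<)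

  nth-mono : ∀ {R : A → A → Set} {xs} → AllPairs R xs → ∀ {r r′} → r ℕ.< r′ → r′ ℕ.< length xs → R (nth xs r) (nth xs r′)
  nth-mono (h ∷ _) {zero} {suc r′} _ (s≤s r′<) = All.lookup h (nth-∈ _ r′ r′<)
  nth-mono (_ ∷ pairs) {suc r} {suc r′} (s≤s r<r′) (s≤s r′<) = nth-mono pairs r<r′ r′<

  nth-++-∷ : ∀ xs {y ys} → nth (xs ++ y ∷ ys) (length xs) ≡ y
  nth-++-∷ [] = refl
  nth-++-∷ (x ∷ xs) = nth-++-∷ xs

<-offset : ∀ {m n} → m ℕ.< n → ∃ λ r → n ≡ m + suc r
<-offset {m} m<n with m≤n⇒∃[o]m+o≡n m<n
... | r , eq = r , trans (sym eq) (sym (+-suc m r))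

offset< : ∀ {u v w} → u ≡ v + suc w → w ℕ.< u
offset< {v = v} {w} eq = subst (w ℕ.<_) (sym eq) (m≤n+m (suc w) v)

module Splice {A : Set} (⋆ : A) {n} {a c : Fin n} (pre : List A) {i : A} (S : List A) {k : A} (T : List A)
         (at-a : length pre ≡ toℕ a) (at-c : toℕ c ≡ toℕ a + suc (length S)) (ends : n ≡ toℕ c + suc (length T)) where

  private
    Z = pre ++ i ∷ S ++ k ∷ T
    ι : Fin n → A
    ι b = nth ⋆ Z (toℕ b)

  length-splice : length Z ≡ n
  length-splice = begin
    length (pre ++ i ∷ S ++ k ∷ T)     ≡⟨ length-++ pre ⟩
    length pre + suc (length (S ++ k ∷ T)) ≡⟨ cong (λ x → length pre + suc x) (length-++ S) ⟩
    length pre + suc (length S + suc (length T)) ≡⟨ cong (_+ _) at-a ⟩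
    toℕ a + suc (length S + suc (length T)) ≡⟨ sym (+-assoc (toℕ a) (suc (length S)) _) ⟩
    toℕ a + suc (length S) + suc (length T) ≡⟨ cong (_+ suc (length T)) (sym at-c) ⟩
    toℕ c + suc (length T)                 ≡⟨ sym ends ⟩
    n ∎
    where open ≡-Reasoning

  splice-at-a : ι a ≡ i
  splice-at-a = trans (cong (nth ⋆ Z) (sym at-a)) (nth-++-∷ ⋆ pre)

  splice-at-c : ι c ≡ k
  splice-at-c = trans (cong (nth ⋆ Z) (trans at-c (cong (_+ suc (length S)) (sym at-a))))
    (trans (nth-++ ⋆ pre (suc (length S))) (nth-++-∷ ⋆ S))

  splice-between : ∀ {b} → a < b → b < c → ι b ∈ₗ S
  splice-between {b} a<b b<c with <-offset a<b
  ... | r , at-b = subst (_∈ₗ S) (sym (begin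
    nth ⋆ Z (toℕ b)                ≡⟨ cong (nth ⋆ Z) (trans at-b (cong (_+ suc r) (sym at-a))) ⟩
    nth ⋆ Z (length pre + suc r)   ≡⟨ nth-++ ⋆ pre (suc r) ⟩
    nth ⋆ (S ++ k ∷ T) r           ≡⟨ nth-++ˡ ⋆ S r r<S ⟩
    nth ⋆ S r                      ∎)) (nth-∈ ⋆ S r r<S)
    where
    open ≡-Reasoning
    r<S : r ℕ.< length S
    r<S = ≤-pred (+-cancelˡ-< (toℕ a) _ _ (subst₂ ℕ._<_ at-b at-c b<c))

  splice-after : ∀ {d} → c < d → ι d ∈ₗ T
  splice-after {d} c<d with <-offset c<d
  ... | r , at-d = subst (_∈ₗ T) (sym (begin
    nth ⋆ Z (toℕ d)                              ≡⟨ cong (nth ⋆ Z) position ⟩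
    nth ⋆ Z (length pre + suc (length S + suc r)) ≡⟨ nth-++ ⋆ pre (suc (length S + suc r)) ⟩
    nth ⋆ (S ++ k ∷ T) (length S + suc r)         ≡⟨ nth-++ ⋆ S (suc r) ⟩
    nth ⋆ T r                                     ∎)) (nth-∈ ⋆ T r r<T)
    where
    open ≡-Reasoning
    position : toℕ d ≡ length pre + suc (length S + suc r)
    position = trans at-d (trans (cong (_+ suc r) at-c)
      (trans (+-assoc (toℕ a) (suc (length S)) (suc r)) (cong (_+ _) (sym at-a))))
    r<T : r ℕ.< length T
    r<T = ≤-pred (+-cancelˡ-< (toℕ c) _ _ (subst₂ ℕ._<_ at-d ends (toℕ<n d)))

frame-order : ∀ {R : A → A → Set} {i M k L j l} → AllPairs R (i ∷ M ++ k ∷ L) → j ∈ₗ M → l ∈ₗ L →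
  R i j × R j k × R k l
frame-order {i = i} {M} sorted j∈M l∈L =
  All.lookup (AllPairs.head sorted) (∈-++⁺ˡ j∈M) ,
  AllPairs-++⁻ (i ∷ M) sorted (there j∈M) (here refl) ,
  All.lookup (AllPairs.head (AllPairs-resp-⊆ sorted (++⁺ˡ (i ∷ M) ⊆-refl))) l∈L

-- Good index sets

Sorted : ∀ {N} → List (Fin N) → Set
Sorted = AllPairs _<_

sublistBound : ℕ → ℕ → ℕ
sublistBound q n = n + suc (rows q n n + suc (columns q n))

module _ {N} (H : PartitionedHypergraph N) (C : Choice H) where

  -- C extended by the full set to non-increasing quadruples, so that goodness makes
  -- sense, and is decidable, for every list, sorted or not.
  C⁺ : (i j k l : Fin N) → Subset (size H i k)
  C⁺ i j k l with i <? j | j <? k | k <? l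
  ... | yes ij | yes jk | yes kl = C ij jk kl
  ... | _ | _ | _ = Subset.⊤

  C⁺-ordered : ∀ {i j k l} (ij : i < j) (jk : j < k) (kl : k < l) → C⁺ i j k l ≡ C ij jk kl
  C⁺-ordered {i} {j} {k} {l} ij jk kl with i <? j | j <? k | k <? l
  ... | yes _ | yes _ | yes _ = refl
  ... | no ¬ij | _ | _ = contradiction ij ¬ij
  ... | yes _ | no ¬jk | _ = contradiction jk ¬jk
  ... | yes _ | yes _ | no ¬kl = contradiction kl ¬kl

  Good : ∀ {n} → (Fin n → Fin N) → Fin n → Fin n → Set
  Good ι a c = ∃ λ (x : Fin (size H (ι a) (ι c))) →
    ∀ b d → a < b → b < c → c < d → x ∈ C⁺ (ι a) (ι b) (ι c) (ι d)

  good? : ∀ {n} (ι : Fin n → Fin N) a c → Dec (Good ι a c)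
  good? ι a c = any? λ x → all? λ b → all? λ d →
    a <? b →-dec b <? c →-dec c <? d →-dec x ∈? C⁺ (ι a) (ι b) (ι c) (ι d)

  good-from-rectangle : ∀ {n} (ι : Fin n → Fin N) {a c i k S T} → ι a ≡ i → ι c ≡ k →
    (x : Fin (size H i k)) → (∀ {b} → a < b → b < c → ι b ∈ₗ S) → (∀ {d} → c < d → ι d ∈ₗ T) →
    (∀ {j l} → j ∈ₗ S → l ∈ₗ T → x ∈ C⁺ i j k l) → Good ι a c
  good-from-rectangle ι refl refl x between after rectangle =
    x , λ b d a<b b<c c<d → rectangle (between a<b b<c) (after c<d)

  -- ⋆ only fills positions past the end of Z; the lists that get compared have length n.
  position : ∀ {n} → Fin N → List (Fin N) → Fin n → Fin N
  position ⋆ Z b = nth ⋆ Z (toℕ b)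

  colour : ∀ {n} → Fin N → Fin n × Fin n → List (Fin N) → Bool
  colour ⋆ (a , c) Z = does (good? (position ⋆ Z) a c)

  good⇒colour-true : ∀ {n} ⋆ {a c : Fin n} Z → Good (position ⋆ Z) a c → colour ⋆ (a , c) Z ≡ true
  good⇒colour-true ⋆ {a} {c} Z = dec-true (good? (position ⋆ Z) a c)

  colour-true⇒good : ∀ {n} ⋆ {a c : Fin n} Z → colour ⋆ (a , c) Z ≡ true → Good (position ⋆ Z) a c
  colour-true⇒good ⋆ {a} {c} Z = does⇒witness (good? (position ⋆ Z) a c)

  dense⁺ : ∀ {p q} → Dense H p q C → ∀ {i j k l} → i < j × j < k × k < l → p * size H i k ≤ q * ∣ C⁺ i j k l ∣
  dense⁺ {p} {q} dense {i} {k = k} (i<j , j<k , k<l) =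
    subst (λ v → p * size H i k ≤ q * ∣ v ∣) (sym (C⁺-ordered i<j j<k k<l)) (dense i<j j<k k<l)

  module _ (⋆ : Fin N) {n} {a c : Fin n} (a<c : a < c) where

    splice-rectangle : ∀ {pre i M k L} → length pre ≡ toℕ a → Rectangle (λ j l → C⁺ i j k l) M L n n →
      ∃ λ Z → Z ⊆ pre ++ i ∷ M ++ k ∷ L × length Z ≡ n × Good (position ⋆ Z) a c
    splice-rectangle {pre} {i} {M} {k} {L} at-a (x , S , T , S⊆M , n≤S , T⊆L , n≤T , rectangle)
      with <-offset a<c | <-offset (toℕ<n c)
    ... | s , at-c | t , ends =
      pre ++ i ∷ S′ ++ k ∷ T′ ,
      ++⁺ ⊆-refl (refl ∷ ++⁺ (⊆-trans (take-⊆ s S) S⊆M) (refl ∷ ⊆-trans (take-⊆ t T) T⊆L)) ,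
      length-splice ,
      good-from-rectangle _ splice-at-a splice-at-c x splice-between splice-after
        (λ j∈S′ l∈T′ → rectangle (Any-resp-⊆ (take-⊆ s S) j∈S′) (Any-resp-⊆ (take-⊆ t T) l∈T′))
      where
      S′ = take s S
      T′ = take t T
      |S′| : length S′ ≡ s
      |S′| = length-take≤ s S (≤-trans (<⇒≤ (≤-trans (offset< at-c) (<⇒≤ (toℕ<n c)))) n≤S)
      |T′| : length T′ ≡ t
      |T′| = length-take≤ t T (≤-trans (<⇒≤ (offset< ends)) n≤T)
      open Splice ⋆ pre S′ T′ at-a (subst (λ u → toℕ c ≡ toℕ a + suc u) (sym |S′|) at-c)
                                  (subst (λ u → n ≡ toℕ c + suc u) (sym |T′|) ends)

    good-sublist : ∀ {p q} .{{_ : NonZero p}} .{{_ : NonZero q}} → Dense H p q C → ∀ {J} → Sorted J →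
      sublistBound q n ≤ length J → ∃ λ Z → Z ⊆ J × length Z ≡ n × Good (position ⋆ Z) a c
    good-sublist {p} {q} dense {J} sorted len
      with frame-sublist (toℕ a) (rows q n n) (columns q n) J (≤-trans (+-monoˡ-≤ _ (<⇒≤ (toℕ<n a))) len)
    ... | pre , i , M , k , L , frame⊆J , at-a , len-M , len-L =
      let Z , Z⊆frame , len-Z , good = splice-rectangle at-a (dense⇒rectangle (λ j l → C⁺ i j k l) {p} {q} n n
                                         (nonempty H (AllPairs-++⁻ (i ∷ M) frame (here refl) (here refl)))
                                         len-L len-M (λ j∈M l∈L → dense⁺ {p} {q} dense (frame-order frame j∈M l∈L)))
      in Z , ⊆-trans Z⊆frame frame⊆J , len-Z , good
      where
      frame : Sorted (i ∷ M ++ k ∷ L)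
      frame = AllPairs-resp-⊆ sorted (⊆-trans (++⁺ˡ pre ⊆-refl) frame⊆J)

  Transversal : ℕ → Set
  Transversal n = Σ (Fin n → Fin N) λ ι → Σ (StrictlyIncreasing ι) λ inc →
    Σ (∀ {a c : Fin n} → .(a < c) → Fin (size H (ι a) (ι c))) λ γ →
      ∀ {a b c d : Fin n} (ab : a < b) (bc : b < c) (cd : c < d) →
        γ {a} {c} (<-trans ab bc) ∈ C (inc ab) (inc bc) (inc cd)

  good⇒transversal : ∀ {n} (ι : Fin n → Fin N) (inc : StrictlyIncreasing ι) →
    (∀ {a c} → a < c → Good ι a c) → Transversal n
  -- γ receives a < c irrelevantly; recompute turns it back into a usable proof.
  good⇒transversal ι inc good = ι , inc , (λ {a} {c} a<c → proj₁ (good (recompute (a <? c) a<c))) ,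
    λ {a} {b} {c} {d} ab bc cd →
      subst (_ ∈_) (C⁺-ordered (inc ab) (inc bc) (inc cd)) (proj₂ (good (recompute (a <? c) (<-trans ab bc))) b d ab bc cd)

  transversal : ∀ {p q} .{{_ : NonZero p}} .{{_ : NonZero q}} → Dense H p q C → (⋆ : Fin N) → ∀ {n J} →
    Sorted J → sublistBound q n ≤ length J → (∀ {a c} → ∃ (Homogeneous n (colour ⋆ (a , c)) J)) → Transversal n
  transversal dense ⋆ {n} {J} sorted len homogeneous = good⇒transversal ι increasing good
    where
    Z₀ = take n J
    ι : Fin n → Fin N
    ι = position ⋆ Z₀
    len-Z₀ : length Z₀ ≡ n
    len-Z₀ = length-take≤ n J (≤-trans (m≤m+n n _) len)
    increasing : StrictlyIncreasing ι
    increasing {a} {b} a<b =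
      nth-mono ⋆ (AllPairs-resp-⊆ sorted (take-⊆ n J)) a<b (subst (toℕ b ℕ.<_) (sym len-Z₀) (toℕ<n b))
    good : ∀ {a c} → a < c → Good ι a c
    good {a} {c} a<c =
      let b , hom = homogeneous {a} {c}
          Z , Z⊆J , len-Z , good-Z = good-sublist ⋆ a<c dense sorted len
      in colour-true⇒good ⋆ Z₀ (trans (hom (take-⊆ n J) len-Z₀) (trans (sym (hom Z⊆J len-Z)) (good⇒colour-true ⋆ Z good-Z)))

lemma14 : (p q : ℕ) → 1 ≤ p → 1 ≤ q → (n : ℕ) →
    ∃ λ (N : ℕ) → (H : PartitionedHypergraph N) → (C : Choice H) → Dense H p q C →
    Σ (Fin n → Fin N) λ ι → Σ (StrictlyIncreasing ι) λ inc →
    Σ (∀ {a c : Fin n} → .(a < c) → Fin (size H (ι a) (ι c))) λ γ →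
    ∀ {a b c d : Fin n} (ab : a < b) (bc : b < c) (cd : c < d) →
    γ {a} {c} (<-trans ab bc) ∈ C (inc ab) (inc bc) (inc cd)
lemma14 p q 1≤p 1≤q n = N , λ H C dense →
  let J , J⊆allFin , len , homogeneous = ramsey-simultaneous n (sublistBound q n) (colour H C zero) pairs
                                           (subst (bound ≤_) (sym (length-tabulate (id {A = Fin N}))) (n≤1+n bound))
  in transversal H C dense zero (AllPairs-resp-⊆ (tabulate⁺-< id) J⊆allFin) len
       (λ {a} {c} → homogeneous (∈-cartesianProduct⁺ (∈-allFin a) (∈-allFin c)))
  where
  instance
    p≢0 : NonZero p
    p≢0 = >-nonZero 1≤p
    q≢0 : NonZero q
    q≢0 = >-nonZero 1≤q
  pairs = cartesianProduct (allFin n) (allFin n)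
  bound = simultaneousBound n (sublistBound q n) pairs
  N = suc bound
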